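{- Let ${\boldsymbol{a}}=(a_1,\dots,a_n)\in A_n$ and let $l$ be the critical position of ${\boldsymbol{a}}$. Then for each $1\le i<l$, exactly one of the following holds: (1) $a_i=0$; (2) $a_i$ is a voided positive entry; (3) $a_i<0$ and $a_{i-1}$ is a voided positive entry. Moreover, if $1\le l\le n-1$, then $\sum_{i=1}^{l-1}a_i=0$, and hence $a_l+a_{l+1}>0$.
   Context: $A_n$ is the set of ${\boldsymbol{a}}=(a_1,\dots,a_n)\in\mathbb{R}^n$ with $\sum_{i=1}^k a_i\ge0$ for all $1\le k\le n$. For $1\le i\le n-1$, $a_i$ is a voided positive entry if $a_i>0$ and $a_i+a_{i+1}=0$. The critical position of ${\boldsymbol{a}}$ is the smallest $l\in\{1,\dots,n-1\}$ with $a_l>0$ and $a_l$ not voided, if such $l$ exists; otherwise it is $l=n$. -}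

module Defs where

open import Data.Nat using (ℕ; zero; suc; _≤_; _<_; _∸_)
open import Data.Nat as N using ()
open import Data.Fin using (Fin; fromℕ<)
open import Data.Nat.Properties using (_<?_)
open import Data.Product using (_×_; Σ; ∃)
open import Data.Sum using (_⊎_)
open import Relation.Nullary using (¬_; yes; no)
open import Relation.Binary.PropositionalEquality using (_≡_)
open import Algebra.Structures using (IsCommutativeRing)
open import Relation.Binary.Structures using (IsStrictTotalOrder)

record RealField : Set₁ where
  infixl 6 _+_
  infixl 7 _*_
  infix 4 _<r_
  field
    R   : Set
    0r  : R
    1r  : R
    _+_ : R → R → R
    _*_ : R → R → R
    -_  : R → R
    _<r_ : R → R → Set
    isCommutativeRing : IsCommutativeRing _≡_ _+_ _*_ -_ 0r 1r
    0≢1        : ¬ (0r ≡ 1r)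
    inverse    : ∀ x → ¬ (x ≡ 0r) → Σ R λ y → x * y ≡ 1r
    isStrictTotalOrder : IsStrictTotalOrder _≡_ _<r_
    +-mono-<   : ∀ x y z → x <r y → x + z <r y + z
    *-pos      : ∀ x y → 0r <r x → 0r <r y → 0r <r x * y
    complete   : (P : R → Set) → Σ R P → (Σ R λ b → ∀ x → P x → (x <r b ⊎ x ≡ b)) →
                 Σ R λ s → (∀ x → P x → (x <r s ⊎ x ≡ s)) ×
                           (∀ b → (∀ x → P x → (x <r b ⊎ x ≡ b)) → (s <r b ⊎ s ≡ b))

ExactlyOne : Set → Set → Set → Set
ExactlyOne P Q S = (P ⊎ Q ⊎ S) × ¬ (P × Q) × ¬ (P × S) × ¬ (Q × S)

module Seq (F : RealField) where
  open RealField F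

  _≤r_ : R → R → Set
  x ≤r y = x <r y ⊎ x ≡ y

  -- 1-based entry a_i of a = (a_1,…,a_n), stored as a : Fin n → R.
  -- Only ever used for 1 ≤ i ≤ n below (the value 0r otherwise is never relevant).
  at : ∀ {n} → (Fin n → R) → ℕ → R
  at {n} a zero = 0r
  at {n} a (suc j) with j <? n
  ... | yes j<n = a (fromℕ< j<n)
  ... | no  _   = 0r

  S : ∀ {n} → (Fin n → R) → ℕ → R
  S a zero    = 0r
  S a (suc k) = S a k + at a (suc k)

  InA : ∀ {n} → (Fin n → R) → Set
  InA {n} a = ∀ k → 1 ≤ k → k ≤ n → 0r ≤r S a k

  Voided : ∀ {n} → (Fin n → R) → ℕ → Set
  Voided {n} a j = 1 ≤ j × j ≤ n ∸ 1 × 0r <r at a j × at a j + at a (suc j) ≡ 0r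

  Good : ∀ {n} → (Fin n → R) → ℕ → Set
  Good a j = 0r <r at a j × ¬ Voided a j

  IsCritical : ∀ {n} → (Fin n → R) → ℕ → Set
  IsCritical {n} a l =
      (1 ≤ l × l ≤ n ∸ 1 × Good a l × (∀ j → 1 ≤ j → j < l → ¬ Good a j))
    ⊎ (l ≡ n × (∀ j → 1 ≤ j → j ≤ n ∸ 1 → ¬ Good a j))

{-# OPTIONS --safe #-}
-- Walk through the prefix a₁ … a_{l−1} keeping the invariant that the prefix sum
-- vanishes either at i or, when a_i is voided, at i − 1. Below the critical
-- position a positive entry must be voided, and a negative one is forced to be the
-- partner of a voided entry, since otherwise a prefix sum would become negative.
-- At l itself the invariant gives S_{l−1} = 0, so S_{l+1} = a_l + a_{l+1} ≥ 0, and
-- equality would make a_l voided.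
module Submission where

open import Defs
open import Data.Nat using (ℕ; zero; suc; _≤_; _<_; _∸_; s≤s; z≤n; _≤?_)
open import Data.Nat.Properties using (≤-refl; ≤-trans; <-≤-trans; <⇒≤; n≤1+n; m∸n≤m; <-irrefl)
open import Data.Fin using (Fin)
open import Data.Product using (_×_; _,_; proj₁; proj₂)
open import Data.Sum using (_⊎_; inj₁; inj₂)
open import Relation.Nullary using (¬_; Dec; contradiction)
open import Relation.Nullary.Decidable using (decidable-stable; _×-dec_)
open import Relation.Binary.PropositionalEquality using (_≡_; refl; sym; trans; subst; subst₂; cong₂; module ≡-Reasoning)
open import Relation.Binary.Definitions using (tri<; tri≈; tri>)
open import Algebra.Structures using (IsCommutativeRing)
open import Relation.Binary.Structures using (IsStrictTotalOrder)

m<n⇒m≤n∸1 : ∀ {m n} → m < n → m ≤ n ∸ 1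
m<n⇒m≤n∸1 {n = suc _} (s≤s m≤n) = m≤n

m≤n∸1⇒m<n : ∀ {m n} → 1 ≤ m → m ≤ n ∸ 1 → m < n
m≤n∸1⇒m<n {n = suc _} _       m≤n = s≤s m≤n
m≤n∸1⇒m<n {n = zero}  (s≤s _) ()

module _ (F : RealField) where
  open RealField F
  open Seq F
  open IsCommutativeRing isCommutativeRing using (+-identityˡ; +-assoc)
  open IsStrictTotalOrder isStrictTotalOrder
    using (compare; irrefl; asym; _<?_; _≟_)

  0≤x⇒x≮0 : ∀ {x} → 0r ≤r x → ¬ (x <r 0r)
  0≤x⇒x≮0 (inj₁ 0<x)  x<0 = asym 0<x x<0
  0≤x⇒x≮0 (inj₂ refl) x<0 = irrefl refl x<0

  x>0∧x+y≡0⇒y<0 : ∀ {x y} → 0r <r x → x + y ≡ 0r → y <r 0r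
  x>0∧x+y≡0⇒y<0 {x} {y} 0<x x+y≡0 =
    subst₂ _<r_ (+-identityˡ y) x+y≡0 (+-mono-< 0r x y 0<x)

  x<0⇒0+x<0 : ∀ {x} → x <r 0r → 0r + x <r 0r
  x<0⇒0+x<0 {x} x<0 = subst (_<r 0r) (sym (+-identityˡ x)) x<0

  EntryKind : ∀ {n} → (Fin n → R) → ℕ → Set
  EntryKind a i = at a i ≡ 0r ⊎ Voided a i ⊎ (at a i <r 0r × Voided a (i ∸ 1))

  entryKind⇒exactlyOne : ∀ {n} (a : Fin n → R) {i} → EntryKind a i →
    ExactlyOne (at a i ≡ 0r) (Voided a i) (at a i <r 0r × Voided a (i ∸ 1))
  entryKind⇒exactlyOne a kind = kind ,
    (λ { (aᵢ≡0 , (_ , _ , 0<aᵢ , _)) → irrefl (sym aᵢ≡0) 0<aᵢ }) ,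
    (λ { (aᵢ≡0 , (aᵢ<0 , _)) → irrefl aᵢ≡0 aᵢ<0 }) ,
    (λ { ((_ , _ , 0<aᵢ , _) , (aᵢ<0 , _)) → asym 0<aᵢ aᵢ<0 })

  voided? : ∀ {n} (a : Fin n → R) j → Dec (Voided a j)
  voided? {n} a j =
    1 ≤? j ×-dec j ≤? n ∸ 1 ×-dec 0r <? at a j ×-dec at a j + at a (suc j) ≟ 0r

  positive∧¬good⇒voided : ∀ {n} (a : Fin n → R) {j} → 0r <r at a j → ¬ Good a j → Voided a j
  positive∧¬good⇒voided a {j} 0<aⱼ ¬good =
    decidable-stable (voided? a j) (λ ¬voided → ¬good (0<aⱼ , ¬voided))

  S≡0⇒S[2+k]≡pair : ∀ {n} (a : Fin n → R) k → S a k ≡ 0r →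
    S a (suc (suc k)) ≡ at a (suc k) + at a (suc (suc k))
  S≡0⇒S[2+k]≡pair a k Sₖ≡0 = begin
    S a k + at a (suc k) + at a (suc (suc k))    ≡⟨ +-assoc (S a k) _ _ ⟩
    S a k + (at a (suc k) + at a (suc (suc k)))  ≡⟨ cong₂ _+_ Sₖ≡0 refl ⟩
    0r + (at a (suc k) + at a (suc (suc k)))     ≡⟨ +-identityˡ _ ⟩
    at a (suc k) + at a (suc (suc k))            ∎
    where open ≡-Reasoning

  PrefixBalanced : ∀ {n} → (Fin n → R) → ℕ → Set
  PrefixBalanced a i = S a i ≡ 0r ⊎ (Voided a i × S a (i ∸ 1) ≡ 0r)

  critical⇒bounded : ∀ {n} (a : Fin n → R) {l} → IsCritical a l → l ≤ n
  critical⇒bounded {n} a (inj₁ (_ , l≤n∸1 , _)) = ≤-trans l≤n∸1 (m∸n≤m n 1)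
  critical⇒bounded a (inj₂ (refl , _))          = ≤-refl

  critical⇒¬good-below : ∀ {n} (a : Fin n → R) {l} → IsCritical a l →
    ∀ j → 1 ≤ j → j < l → ¬ Good a j
  critical⇒¬good-below a (inj₁ (_ , _ , _ , ¬good)) = ¬good
  critical⇒¬good-below a (inj₂ (refl , ¬good)) j 1≤j j<n = ¬good j 1≤j (m<n⇒m≤n∸1 j<n)

  critical-interior⇒good : ∀ {n} (a : Fin n → R) {l} → IsCritical a l →
    1 ≤ l → l ≤ n ∸ 1 → Good a l
  critical-interior⇒good a (inj₁ (_ , _ , good , _)) _ _ = good
  critical-interior⇒good a (inj₂ (refl , _)) 1≤n n≤n∸1 =
    contradiction (m≤n∸1⇒m<n 1≤n n≤n∸1) (<-irrefl refl)

  module _ {n} (a : Fin n → R) (inA : InA a) {l} (critical : IsCritical a l) where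

    step-from-zero-sum : ∀ i → suc i < l → S a i ≡ 0r →
      EntryKind a (suc i) × PrefixBalanced a (suc i)
    step-from-zero-sum i 1+i<l Sᵢ≡0 with compare 0r (at a (suc i))
    ... | tri> _ _ aᵢ₊₁<0 = contradiction Sᵢ₊₁<0 (0≤x⇒x≮0 (inA (suc i) (s≤s z≤n) 1+i≤n))
      where
      Sᵢ₊₁<0 : S a (suc i) <r 0r
      Sᵢ₊₁<0 = subst (λ s → s + at a (suc i) <r 0r) (sym Sᵢ≡0) (x<0⇒0+x<0 aᵢ₊₁<0)
      1+i≤n : suc i ≤ n
      1+i≤n = <⇒≤ (<-≤-trans 1+i<l (critical⇒bounded a critical))
    ... | tri≈ _ 0≡aᵢ₊₁ _ =
      inj₁ (sym 0≡aᵢ₊₁) , inj₁ (trans (cong₂ _+_ Sᵢ≡0 (sym 0≡aᵢ₊₁)) (+-identityˡ 0r))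
    ... | tri< 0<aᵢ₊₁ _ _ = inj₂ (inj₁ voided) , inj₂ (voided , Sᵢ≡0)
      where
      voided : Voided a (suc i)
      voided = positive∧¬good⇒voided a 0<aᵢ₊₁
                 (critical⇒¬good-below a critical (suc i) (s≤s z≤n) 1+i<l)

    step-from-voided : ∀ i → Voided a i → S a (i ∸ 1) ≡ 0r →
      EntryKind a (suc i) × PrefixBalanced a (suc i)
    step-from-voided (suc k) voided@(_ , _ , 0<aᵢ , pair≡0) Sₖ≡0 =
      inj₂ (inj₂ (x>0∧x+y≡0⇒y<0 0<aᵢ pair≡0 , voided)) ,
      inj₁ (trans (S≡0⇒S[2+k]≡pair a k Sₖ≡0) pair≡0)

    step : ∀ i → suc i < l → PrefixBalanced a i → EntryKind a (suc i) × PrefixBalanced a (suc i)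
    step i 1+i<l (inj₁ Sᵢ≡0)             = step-from-zero-sum i 1+i<l Sᵢ≡0
    step i _     (inj₂ (voided , Sᵢ₋₁≡0)) = step-from-voided i voided Sᵢ₋₁≡0

    balanced-below : ∀ i → i < l → PrefixBalanced a i
    balanced-below zero    _     = inj₁ refl
    balanced-below (suc i) 1+i<l = proj₂ (step i 1+i<l (balanced-below i (≤-trans (n≤1+n _) 1+i<l)))

    entryKind-below : ∀ i → 1 ≤ i → i < l → EntryKind a i
    entryKind-below (suc i) _ 1+i<l = proj₁ (step i 1+i<l (balanced-below i (≤-trans (n≤1+n _) 1+i<l)))

  balanced∧next-positive⇒S≡0 : ∀ {n} (a : Fin n → R) {k} → PrefixBalanced a k →
    0r <r at a (suc k) → S a k ≡ 0r
  balanced∧next-positive⇒S≡0 a (inj₁ Sₖ≡0) _ = Sₖ≡0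
  balanced∧next-positive⇒S≡0 a (inj₂ ((_ , _ , 0<aₖ , pair≡0) , _)) 0<aₖ₊₁ =
    contradiction (x>0∧x+y≡0⇒y<0 0<aₖ pair≡0) (asym 0<aₖ₊₁)

  critical-prefix : ∀ {n} (a : Fin n → R) → InA a → ∀ {l} → IsCritical a l →
    1 ≤ l → l ≤ n ∸ 1 → S a (l ∸ 1) ≡ 0r × 0r <r at a l + at a (suc l)
  critical-prefix a inA {suc m} critical 1≤l l≤n∸1 = Sₘ≡0 , 0<pair
    where
    good : Good a (suc m)
    good = critical-interior⇒good a critical 1≤l l≤n∸1

    Sₘ≡0 : S a m ≡ 0r
    Sₘ≡0 = balanced∧next-positive⇒S≡0 a (balanced-below a inA critical m ≤-refl) (proj₁ good)

    0<pair : 0r <r at a (suc m) + at a (suc (suc m))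
    0<pair with inA (suc (suc m)) (s≤s z≤n) (m≤n∸1⇒m<n 1≤l l≤n∸1)
    ... | inj₁ 0<S = subst (0r <r_) (S≡0⇒S[2+k]≡pair a m Sₘ≡0) 0<S
    ... | inj₂ 0≡S = contradiction (1≤l , l≤n∸1 , proj₁ good ,
                                    sym (trans 0≡S (S≡0⇒S[2+k]≡pair a m Sₘ≡0)))
                                   (proj₂ good)

lemma5p5 : (F : RealField) (n : ℕ) (a : Fin n → RealField.R F) →
    Seq.InA F a → (l : ℕ) → Seq.IsCritical F a l →
    (∀ i → 1 ≤ i → i < l →
       ExactlyOne (Seq.at F a i ≡ RealField.0r F)
                  (Seq.Voided F a i)
                  (RealField._<r_ F (Seq.at F a i) (RealField.0r F) × Seq.Voided F a (i ∸ 1)))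
    × (1 ≤ l → l ≤ n ∸ 1 →
       (Seq.S F a (l ∸ 1) ≡ RealField.0r F)
       × RealField._<r_ F (RealField.0r F) (RealField._+_ F (Seq.at F a l) (Seq.at F a (suc l))))
lemma5p5 F n a inA l critical =
  (λ i 1≤i i<l → entryKind⇒exactlyOne F a (entryKind-below F a inA critical i 1≤i i<l)) ,
  critical-prefix F a inA critical
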